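{- Let $a\ge1$ and $s\ge 1$ be integers. For every graph $G \in \mathcal{C}_5$, we have $\Sigma_{G^{(a)}}(s) = a\binom{s}{2} + \big\lfloor \frac{s^2}{10} + \frac{s}{2}\big\rfloor$.
   Context: A multigraph is a finite vertex set with a function $w$ assigning non-negative integer multiplicities to pairs of vertices; $e(G)$ is the sum of all multiplicities. A pattern $P$ on a finite set $V(P)$ assigns non-negative integer multiplicities $P(\{v\})$ to vertices (loops) and $P(\{u,v\})$ to pairs. A blow-up of $P$ on $[s]$ is a multigraph on $[s]$ with a map $f\colon[s]\to V(P)$ (not necessarily surjective) such that $w(vv')=P(\{f(v),f(v')\})$ for all distinct $v,v'$ (a loop multiplicity if $f(v)=f(v')$). $\Sigma_P(s)$ is the maximum of $e(G)$ over blow-ups $G$ of $P$ on $[s]$. For a graph $H$ and integer $a\ge1$, $H^{(a)}$ is the pattern on $V(H)$ with every loop of multiplicity $a-1$, non-adjacent pairs of multiplicity $a$, and edges of multiplicity $a+1$. $\mathcal{C}_5=\{K_{1,3}, C_5, H_6, H_7, H_9, \mathrm{Petersen}\}$, where $K_{1,3}$ is the star with 3 leaves, $C_5$ the 5-cycle, $H_6$ the graph on $[6]$ with edges $12,13,14,25,26$, $H_7$ the graph on $[7]$ with edges $12,23,34,45,15,16,67,74$, $H_9$ the graph on $[9]$ with edges $12,23,34,45,56,16,17,74,28,85,39,96$, and $\mathrm{Petersen}$ the Petersen graph (the unique 3-regular graph of girth 5 on 10 vertices). -}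

module Defs where

open import Data.Nat using (ℕ; zero; suc; _+_; _*_; _∸_; _/_; _≤_; _≡ᵇ_)
open import Data.Nat.Combinatorics using (_C_)
open import Data.Fin using (Fin; zero; suc; toℕ; _≟_)
open import Data.Bool using (Bool; true; false; if_then_else_; _∧_; _∨_)
open import Data.List using (List; []; _∷_)
open import Data.Bool.ListAction using (any)
open import Data.Product using (_×_; _,_; Σ)
open import Relation.Nullary.Decidable using (⌊_⌋)
open import Relation.Binary.PropositionalEquality using (_≡_)

-- Simple graphs on vertex set Fin n, given by an edge list with 1-based labels
-- (vertex i : Fin n carries the paper's label toℕ i + 1).
record Graph : Set where
  field
    size  : ℕ
    edges : List (ℕ × ℕ)

open Graph public

adj : (G : Graph) → Fin (size G) → Fin (size G) → Bool
adj G i j = any (λ { (u , v) → ((suc (toℕ i) ≡ᵇ u) ∧ (suc (toℕ j) ≡ᵇ v))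
                             ∨ ((suc (toℕ i) ≡ᵇ v) ∧ (suc (toℕ j) ≡ᵇ u)) }) (edges G)

-- A pattern on Fin n: P u u is the loop multiplicity P({u}),
-- P u v (u ≠ v) the multiplicity P({u,v}) (symmetric for all patterns used here).
Pattern : ℕ → Set
Pattern n = Fin n → Fin n → ℕ

_^⟨_⟩ : (H : Graph) → ℕ → Pattern (size H)
(H ^⟨ a ⟩) u v =
  if ⌊ u ≟ v ⌋ then a ∸ 1 else (if adj H u v then suc a else a)

sumFin : ∀ {n} → (Fin n → ℕ) → ℕ
sumFin {zero}  g = 0
sumFin {suc n} g = g zero + sumFin (λ i → g (suc i))

-- e(G) of a multigraph on Fin s with multiplicity function w: sum over
-- unordered pairs {i,j}, i ≠ j, of w i j (computed as sum over i < j).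
edgeCount : ∀ {s} → (Fin s → Fin s → ℕ) → ℕ
edgeCount {zero}  w = 0
edgeCount {suc s} w = sumFin (λ j → w zero (suc j)) + edgeCount (λ i j → w (suc i) (suc j))

blowUp : ∀ {n s} → Pattern n → (Fin s → Fin n) → Fin s → Fin s → ℕ
blowUp P f v v' = P (f v) (f v')

IsΣ : ∀ {n} → Pattern n → (s m : ℕ) → Set
IsΣ {n} P s m =
  Σ (Fin s → Fin n) (λ f → edgeCount (blowUp P f) ≡ m)
  × ((f : Fin s → Fin n) → edgeCount (blowUp P f) ≤ m)

data C5 : Set where
  K13 C5cycle H6 H7 H9 Petersen : C5

graphOf : C5 → Graph
graphOf K13 = record { size = 4 ; edges = (1 , 2) ∷ (1 , 3) ∷ (1 , 4) ∷ [] }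
graphOf C5cycle = record { size = 5 ; edges = (1 , 2) ∷ (2 , 3) ∷ (3 , 4) ∷ (4 , 5) ∷ (5 , 1) ∷ [] }
graphOf H6 = record { size = 6 ; edges = (1 , 2) ∷ (1 , 3) ∷ (1 , 4) ∷ (2 , 5) ∷ (2 , 6) ∷ [] }
graphOf H7 = record { size = 7 ; edges =
  (1 , 2) ∷ (2 , 3) ∷ (3 , 4) ∷ (4 , 5) ∷ (1 , 5) ∷ (1 , 6) ∷ (6 , 7) ∷ (7 , 4) ∷ [] }
graphOf H9 = record { size = 9 ; edges =
  (1 , 2) ∷ (2 , 3) ∷ (3 , 4) ∷ (4 , 5) ∷ (5 , 6) ∷ (1 , 6) ∷ (1 , 7) ∷ (7 , 4) ∷
  (2 , 8) ∷ (8 , 5) ∷ (3 , 9) ∷ (9 , 6) ∷ [] }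
-- Petersen: outer 5-cycle 1..5, spokes i–(i+5), inner pentagram on 6..10
graphOf Petersen = record { size = 10 ; edges =
  (1 , 2) ∷ (2 , 3) ∷ (3 , 4) ∷ (4 , 5) ∷ (5 , 1) ∷
  (1 , 6) ∷ (2 , 7) ∷ (3 , 8) ∷ (4 , 9) ∷ (5 , 10) ∷
  (6 , 8) ∷ (8 , 10) ∷ (10 , 7) ∷ (7 , 9) ∷ (9 , 6) ∷ [] }

-- a * C(s,2) + ⌊ s²/10 + s/2 ⌋ = a * C(s,2) + ⌊ (s² + 5s)/10 ⌋
target : ℕ → ℕ → ℕ
target a s = a * (s C 2) + (s * s + 5 * s) / 10

module Submission where

-- Since H^(b+1) = b + H^(1) entrywise, and adding b to every multiplicity adds b·C(s,2) edges
-- to every blow-up on [s], it suffices to take a = 1, where the claim reads Σ(s) = ⌊3s²/5⌋.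
-- For a blow-up along f, twice its edge count is Σ_{i,j} P(f i, f j), a quadratic form in the
-- part sizes. For each graph in 𝒞₅ the form 36 J − 30 H^(1) (J the all-ones matrix) is an
-- explicit nonnegative combination of squares of linear forms, whence 60 e ≤ 36 s², i.e.
-- 5 e ≤ 3 s². Conversely, five suitable vertices (an induced C₅ when H has one) span 15 edges,
-- and every vertex of H^(1) sends total multiplicity 6 to them, so blowing them up
-- cyclically gives e(5 + m) = 15 + 6 m + e(m), which is the recursion of ⌊3s²/5⌋.

open import Defs
open import Data.Bool using (true; false; if_then_else_; _∧_; _∨_)
open import Data.Bool.ListAction using (or)
open import Data.Bool.Properties using (∧-comm; ∨-comm)
open import Data.Fin using (Fin; zero; suc; toℕ; _↑ˡ_; _↑ʳ_; _≟_)
open import Data.Fin.Patterns using (0F; 1F; 2F; 3F; 4F; 6F)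
open import Data.Fin.Properties using (all?; toℕ-↑ˡ; toℕ-↑ʳ; toℕ<n; fromℕ<-cong; fromℕ<-toℕ)
open import Data.List using (List; []; _∷_)
open import Data.List.Properties using (map-cong)
open import Data.Nat using (ℕ; zero; suc; _+_; _*_; _∸_; _/_; _≤_; _≡ᵇ_; NonZero)
open import Data.Nat using () renaming (_≟_ to _≟ℕ_)
open import Data.Nat.Combinatorics using (_C_; nCk+nC[k+1]≡[n+1]C[k+1]; nC1≡n)
open import Data.Nat.DivMod
  using (_mod_; _%_; m<n⇒m%n≡m; [m+n]%n≡m%n; m*n/n≡m; +-distrib-/-∣ˡ; +-distrib-/-∣ʳ; m*n/m*o≡n/o; /-monoˡ-≤)
open import Data.Nat.Divisibility using (divides-refl)
open import Data.Nat.Properties hiding (_≟_)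
open import Algebra.Properties.Semiring.Sum +-*-semiring
  using (sum; sum-cong-≗; ∑-distrib-+; ∑-comm; *-distribˡ-sum; *-distribʳ-sum)
open import Data.Nat.Tactic.RingSolver using (solve-∀)
open import Data.Product using (_,_)
open import Data.Sum using ([_,_]′)
open import Data.Vec using ([]; _∷_; lookup)
open import Relation.Binary.PropositionalEquality
open import Relation.Nullary using (yes; no; contradiction)
open import Relation.Nullary.Decidable using (⌊_⌋; True; toWitness)

sumFin≡sum : ∀ {n} (g : Fin n → ℕ) → sumFin g ≡ sum g
sumFin≡sum {zero}  g = refl
sumFin≡sum {suc n} g = cong (g zero +_) (sumFin≡sum (λ i → g (suc i)))

sum-const : ∀ {m} {g : Fin m → ℕ} {d} → (∀ i → g i ≡ d) → sum g ≡ m * d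
sum-const {zero}  g≗d = refl
sum-const {suc m} g≗d = cong₂ _+_ (g≗d zero) (sum-const (λ i → g≗d (suc i)))

sum-↑ : ∀ k {m} (g : Fin (k + m) → ℕ) →
  sum g ≡ sum (λ i → g (i ↑ˡ m)) + sum (λ j → g (k ↑ʳ j))
sum-↑ zero    g = refl
sum-↑ (suc k) g = trans (cong (g zero +_) (sum-↑ k (λ i → g (suc i)))) (sym (+-assoc (g zero) _ _))

pairSum : ∀ {s} → (Fin s → Fin s → ℕ) → ℕ
pairSum w = sum λ i → sum λ j → w i j

pairSum-cong : ∀ {s} {w w′ : Fin s → Fin s → ℕ} → (∀ i j → w i j ≡ w′ i j) →
  pairSum w ≡ pairSum w′
pairSum-cong w≗w′ = sum-cong-≗ (λ i → sum-cong-≗ (w≗w′ i))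

pairSum-+ : ∀ {s} (w w′ : Fin s → Fin s → ℕ) →
  pairSum (λ i j → w i j + w′ i j) ≡ pairSum w + pairSum w′
pairSum-+ w w′ =
  trans (sum-cong-≗ (λ i → ∑-distrib-+ (w i) (w′ i))) (∑-distrib-+ (λ i → sum (w i)) (λ i → sum (w′ i)))

*-distribˡ-pairSum : ∀ {s} k (w : Fin s → Fin s → ℕ) → k * pairSum w ≡ pairSum (λ i j → k * w i j)
*-distribˡ-pairSum k w =
  trans (*-distribˡ-sum k (λ i → sum (w i))) (sum-cong-≗ (λ i → *-distribˡ-sum k (w i)))

sum*sum≡pairSum : ∀ {s} (x y : Fin s → ℕ) → sum x * sum y ≡ pairSum (λ i j → x i * y j)
sum*sum≡pairSum x y = trans (*-distribʳ-sum (sum y) x) (sum-cong-≗ (λ i → *-distribˡ-sum (x i) y))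

Symmetric : ∀ {s} → (Fin s → Fin s → ℕ) → Set
Symmetric w = ∀ i j → w i j ≡ w j i

2*edgeCount≡pairSum : ∀ {s} (w : Fin s → Fin s → ℕ) → Symmetric w → (∀ i → w i i ≡ 0) →
  2 * edgeCount w ≡ pairSum w
2*edgeCount≡pairSum {zero}  w sym-w diagonal = refl
2*edgeCount≡pairSum {suc s} w sym-w diagonal = begin
  2 * (sumFin row + edgeCount w′)
    ≡⟨ cong (λ r → 2 * (r + edgeCount w′)) (sumFin≡sum row) ⟩
  2 * (sum row + edgeCount w′)
    ≡⟨ rearrange (sum row) (edgeCount w′) ⟩
  sum row + (sum row + 2 * edgeCount w′)
    ≡⟨ cong₂ (λ c p → sum row + (c + p)) column
         (2*edgeCount≡pairSum w′ (λ i j → sym-w (suc i) (suc j)) (λ i → diagonal (suc i))) ⟩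
  sum row + (sum (λ i → w (suc i) zero) + pairSum w′)
    ≡⟨ cong₂ (λ d r → d + sum row + r) (diagonal zero)
         (∑-distrib-+ (λ i → w (suc i) zero) (λ i → sum (w′ i))) ⟨
  pairSum w ∎
  where
  open ≡-Reasoning
  row : Fin s → ℕ
  row j = w zero (suc j)
  w′ : Fin s → Fin s → ℕ
  w′ i j = w (suc i) (suc j)
  column : sum row ≡ sum (λ i → w (suc i) zero)
  column = sum-cong-≗ (λ j → sym-w zero (suc j))
  rearrange : ∀ r e → 2 * (r + e) ≡ r + (r + 2 * e)
  rearrange = solve-∀

-- Sums of squares

x*y+y*x≤x*x+y*y : ∀ x y → x * y + y * x ≤ x * x + y * y
x*y+y*x≤x*x+y*y x y = [ ordered , flipped ]′ (≤-total x y)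
  where
  -- with y = x + d the gap between the two sides is d * d
  ordered : ∀ {x y} → x ≤ y → x * y + y * x ≤ x * x + y * y
  ordered {x} x≤y = subst (λ y → x * y + y * x ≤ x * x + y * y) (m+[n∸m]≡n x≤y)
    (≤-trans (m≤m+n _ _) (≤-reflexive (gap x _)))
    where
    gap : ∀ x d → x * (x + d) + (x + d) * x + d * d ≡ x * x + (x + d) * (x + d)
    gap = solve-∀
  flipped : y ≤ x → x * y + y * x ≤ x * x + y * y
  flipped y≤x = subst₂ _≤_ (+-comm (y * x) (x * y)) (+-comm (y * y) (x * x)) (ordered y≤x)

record WeightedSquare (n : ℕ) : Set where
  constructor _*⟨_-_⟩²
  field
    weight : ℕ
    pos neg : Fin n → ℕ

open WeightedSquare

crossTerms squareTerms : ∀ {n} → List (WeightedSquare n) → Fin n → Fin n → ℕ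
crossTerms []       u v = 0
crossTerms (t ∷ ts) u v = weight t * (pos t u * neg t v + neg t u * pos t v) + crossTerms ts u v
squareTerms []       u v = 0
squareTerms (t ∷ ts) u v = weight t * (pos t u * pos t v + neg t u * neg t v) + squareTerms ts u v

-- M − N = Σ weight * (pos − neg)(pos − neg)ᵀ, with the cross terms moved to the left.
SumOfSquares : ∀ {n} (M N : Fin n → Fin n → ℕ) → List (WeightedSquare n) → Set
SumOfSquares M N ts = ∀ u v → M u v + crossTerms ts u v ≡ N u v + squareTerms ts u v

pairSum-weighted : ∀ {s} w (a b c d : Fin s → ℕ) →
  pairSum (λ i j → w * (a i * b j + c i * d j)) ≡ w * (sum a * sum b + sum c * sum d)
pairSum-weighted w a b c d = begin
  pairSum (λ i j → w * (a i * b j + c i * d j))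
    ≡⟨ *-distribˡ-pairSum w (λ i j → a i * b j + c i * d j) ⟨
  w * pairSum (λ i j → a i * b j + c i * d j)
    ≡⟨ cong (w *_) (pairSum-+ (λ i j → a i * b j) (λ i j → c i * d j)) ⟩
  w * (pairSum (λ i j → a i * b j) + pairSum (λ i j → c i * d j))
    ≡⟨ cong (w *_) (cong₂ _+_ (sum*sum≡pairSum a b) (sum*sum≡pairSum c d)) ⟨
  w * (sum a * sum b + sum c * sum d) ∎
  where open ≡-Reasoning

pairSum-crossTerms≤pairSum-squareTerms : ∀ {n s} ts (f : Fin s → Fin n) →
  pairSum (blowUp (crossTerms ts) f) ≤ pairSum (blowUp (squareTerms ts) f)
pairSum-crossTerms≤pairSum-squareTerms []                     f = ≤-refl
pairSum-crossTerms≤pairSum-squareTerms ts@((w *⟨ p - q ⟩²) ∷ ts′) f = begin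
  pairSum (blowUp (crossTerms ts) f)
    ≡⟨ pairSum-+ (λ i j → w * (p′ i * q′ j + q′ i * p′ j)) (blowUp (crossTerms ts′) f) ⟩
  pairSum (λ i j → w * (p′ i * q′ j + q′ i * p′ j)) + pairSum (blowUp (crossTerms ts′) f)
    ≤⟨ +-mono-≤ (≤-reflexive (pairSum-weighted w p′ q′ q′ p′))
                (pairSum-crossTerms≤pairSum-squareTerms ts′ f) ⟩
  w * (sum p′ * sum q′ + sum q′ * sum p′) + pairSum (blowUp (squareTerms ts′) f)
    ≤⟨ +-monoˡ-≤ _ (*-monoʳ-≤ w (x*y+y*x≤x*x+y*y (sum p′) (sum q′))) ⟩
  w * (sum p′ * sum p′ + sum q′ * sum q′) + pairSum (blowUp (squareTerms ts′) f)
    ≡⟨ cong (_+ pairSum (blowUp (squareTerms ts′) f)) (pairSum-weighted w p′ p′ q′ q′) ⟨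
  pairSum (λ i j → w * (p′ i * p′ j + q′ i * q′ j)) + pairSum (blowUp (squareTerms ts′) f)
    ≡⟨ pairSum-+ (λ i j → w * (p′ i * p′ j + q′ i * q′ j)) (blowUp (squareTerms ts′) f) ⟨
  pairSum (blowUp (squareTerms ts) f) ∎
  where
  open ≤-Reasoning
  p′ q′ : _ → ℕ
  p′ i = p (f i)
  q′ i = q (f i)

SumOfSquares⇒pairSum-≤ : ∀ {n} {M N : Fin n → Fin n → ℕ} {ts} → SumOfSquares M N ts →
  ∀ {s} (f : Fin s → Fin n) → pairSum (blowUp N f) ≤ pairSum (blowUp M f)
SumOfSquares⇒pairSum-≤ {M = M} {N} {ts} M-N≡ts f =
  +-cancelʳ-≤ (pairSum (blowUp (squareTerms ts) f)) _ _ (begin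
    pairSum (blowUp N f) + pairSum (blowUp (squareTerms ts) f)
      ≡⟨ pairSum-+ (blowUp N f) (blowUp (squareTerms ts) f) ⟨
    pairSum (λ i j → N (f i) (f j) + squareTerms ts (f i) (f j))
      ≡⟨ pairSum-cong (λ i j → M-N≡ts (f i) (f j)) ⟨
    pairSum (λ i j → M (f i) (f j) + crossTerms ts (f i) (f j))
      ≡⟨ pairSum-+ (blowUp M f) (blowUp (crossTerms ts) f) ⟩
    pairSum (blowUp M f) + pairSum (blowUp (crossTerms ts) f)
      ≤⟨ +-monoʳ-≤ _ (pairSum-crossTerms≤pairSum-squareTerms ts f) ⟩
    pairSum (blowUp M f) + pairSum (blowUp (squareTerms ts) f) ∎)
  where open ≤-Reasoning

-- Edge counts of blow-ups

edgeCount-cong : ∀ {s} {w w′ : Fin s → Fin s → ℕ} → (∀ i j → w i j ≡ w′ i j) →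
  edgeCount w ≡ edgeCount w′
edgeCount-cong {zero}  w≗w′ = refl
edgeCount-cong {suc s} w≗w′ =
  cong₂ _+_ (sumFin-cong (λ j → w≗w′ zero (suc j))) (edgeCount-cong (λ i j → w≗w′ (suc i) (suc j)))
  where
  sumFin-cong : ∀ {n} {g h : Fin n → ℕ} → (∀ i → g i ≡ h i) → sumFin g ≡ sumFin h
  sumFin-cong {g = g} {h} g≗h = trans (sumFin≡sum g) (trans (sum-cong-≗ g≗h) (sym (sumFin≡sum h)))

suc[s]C2≡s+sC2 : ∀ s → suc s C 2 ≡ s + s C 2
suc[s]C2≡s+sC2 s = trans (sym (nCk+nC[k+1]≡[n+1]C[k+1] s 1)) (cong (_+ s C 2) (nC1≡n s))

edgeCount-+ : ∀ {s} b (w : Fin s → Fin s → ℕ) →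
  edgeCount (λ i j → b + w i j) ≡ b * (s C 2) + edgeCount w
edgeCount-+ {zero}  b w = sym (trans (+-identityʳ (b * 0)) (*-zeroʳ b))
edgeCount-+ {suc s} b w = begin
  sumFin (λ j → b + row j) + edgeCount (λ i j → b + w′ i j)
    ≡⟨ cong₂ _+_ (sumFin≡sum (λ j → b + row j)) (edgeCount-+ b w′) ⟩
  sum (λ j → b + row j) + (b * (s C 2) + edgeCount w′)
    ≡⟨ cong (_+ (b * (s C 2) + edgeCount w′)) (∑-distrib-+ (λ _ → b) row) ⟩
  (sum {s} (λ _ → b) + sum row) + (b * (s C 2) + edgeCount w′)
    ≡⟨ cong₂ (λ x y → (x + y) + (b * (s C 2) + edgeCount w′))
         (sum-const {s} (λ _ → refl)) (sym (sumFin≡sum row)) ⟩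
  (s * b + sumFin row) + (b * (s C 2) + edgeCount w′)
    ≡⟨ rearrange s b (s C 2) (sumFin row) (edgeCount w′) ⟩
  b * (s + s C 2) + (sumFin row + edgeCount w′)
    ≡⟨ cong (λ c → b * c + (sumFin row + edgeCount w′)) (suc[s]C2≡s+sC2 s) ⟨
  b * (suc s C 2) + edgeCount w ∎
  where
  open ≡-Reasoning
  row : Fin s → ℕ
  row j = w zero (suc j)
  w′ : Fin s → Fin s → ℕ
  w′ i j = w (suc i) (suc j)
  rearrange : ∀ s b c r e → (s * b + r) + (b * c + e) ≡ b * (s + c) + (r + e)
  rearrange = solve-∀

edgeCount-↑ : ∀ k {m} (w : Fin (k + m) → Fin (k + m) → ℕ) →
  edgeCount w ≡ edgeCount (λ i j → w (i ↑ˡ m) (j ↑ˡ m))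
              + sum (λ i → sum (λ j → w (i ↑ˡ m) (k ↑ʳ j)))
              + edgeCount (λ i j → w (k ↑ʳ i) (k ↑ʳ j))
edgeCount-↑ zero    w = refl
edgeCount-↑ (suc k) {m} w = begin
  sumFin row + edgeCount w′
    ≡⟨ cong₂ _+_ (trans (sumFin≡sum row) (sum-↑ k row)) (edgeCount-↑ k w′) ⟩
  (sum (λ j → row (j ↑ˡ m)) + sum (λ j → row (k ↑ʳ j))) + (inner + between + outer)
    ≡⟨ rearrange (sum (λ j → row (j ↑ˡ m))) (sum (λ j → row (k ↑ʳ j))) inner between outer ⟩
  (sum (λ j → row (j ↑ˡ m)) + inner) + (sum (λ j → row (k ↑ʳ j)) + between) + outer
    ≡⟨ cong (λ x → (x + inner) + (sum (λ j → row (k ↑ʳ j)) + between) + outer)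
         (sumFin≡sum (λ j → row (j ↑ˡ m))) ⟨
  edgeCount (λ i j → w (i ↑ˡ m) (j ↑ˡ m))
    + sum (λ i → sum (λ j → w (i ↑ˡ m) (suc k ↑ʳ j)))
    + edgeCount (λ i j → w (suc k ↑ʳ i) (suc k ↑ʳ j)) ∎
  where
  open ≡-Reasoning
  row : Fin (k + m) → ℕ
  row j = w zero (suc j)
  w′ : Fin (k + m) → Fin (k + m) → ℕ
  w′ i j = w (suc i) (suc j)
  inner between outer : ℕ
  inner = edgeCount (λ i j → w′ (i ↑ˡ m) (j ↑ˡ m))
  between = sum (λ i → sum (λ j → w′ (i ↑ˡ m) (k ↑ʳ j)))
  outer = edgeCount (λ i j → w′ (k ↑ʳ i) (k ↑ʳ j))
  rearrange : ∀ a b x y z → (a + b) + (x + y + z) ≡ (a + x) + (b + y) + z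
  rearrange = solve-∀

cycle : ∀ {k n} .{{_ : NonZero k}} → (Fin k → Fin n) → ∀ s → Fin s → Fin n
cycle {k} g s i = g (toℕ i mod k)

module _ {k n} .{{_ : NonZero k}} (g : Fin k → Fin n) where

  cycle-↑ˡ : ∀ m (i : Fin k) → cycle g (k + m) (i ↑ˡ m) ≡ g i
  cycle-↑ˡ m i = cong g (trans
    (fromℕ<-cong _ (toℕ i) (trans (cong (_% k) (toℕ-↑ˡ i m)) (m<n⇒m%n≡m (toℕ<n i))) _ _)
    (fromℕ<-toℕ i (toℕ<n i)))

  cycle-↑ʳ : ∀ m (j : Fin m) → cycle g (k + m) (k ↑ʳ j) ≡ cycle g m j
  cycle-↑ʳ m j = cong g (fromℕ<-cong _ _
    (trans (cong (_% k) (trans (toℕ-↑ʳ k j) (+-comm k (toℕ j)))) ([m+n]%n≡m%n (toℕ j) k)) _ _)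

  edgeCount-cycle : ∀ (P : Pattern n) d → (∀ t → sum (λ i → P (g i) (g t)) ≡ d) → ∀ m →
    edgeCount (blowUp P (cycle g (k + m))) ≡
      edgeCount (blowUp P g) + m * d + edgeCount (blowUp P (cycle g m))
  edgeCount-cycle P d degree m = begin
    edgeCount (blowUp P (cycle g (k + m)))
      ≡⟨ edgeCount-↑ k (blowUp P (cycle g (k + m))) ⟩
    edgeCount (λ i j → P (cycle g (k + m) (i ↑ˡ m)) (cycle g (k + m) (j ↑ˡ m)))
      + sum (λ i → sum (λ j → P (cycle g (k + m) (i ↑ˡ m)) (cycle g (k + m) (k ↑ʳ j))))
      + edgeCount (λ i j → P (cycle g (k + m) (k ↑ʳ i)) (cycle g (k + m) (k ↑ʳ j)))
      ≡⟨ cong₂ _+_ (cong₂ _+_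
           (edgeCount-cong (λ i j → cong₂ P (cycle-↑ˡ m i) (cycle-↑ˡ m j)))
           (sum-cong-≗ (λ i → sum-cong-≗ (λ j → cong₂ P (cycle-↑ˡ m i) (cycle-↑ʳ m j)))))
           (edgeCount-cong (λ i j → cong₂ P (cycle-↑ʳ m i) (cycle-↑ʳ m j))) ⟩
    edgeCount (blowUp P g)
      + sum (λ i → sum (λ j → P (g i) (cycle g m j)))
      + edgeCount (blowUp P (cycle g m))
      ≡⟨ cong (λ x → edgeCount (blowUp P g) + x + edgeCount (blowUp P (cycle g m))) between ⟩
    edgeCount (blowUp P g) + m * d + edgeCount (blowUp P (cycle g m)) ∎
    where
    open ≡-Reasoning
    between : sum (λ i → sum (λ j → P (g i) (cycle g m j))) ≡ m * d
    between = trans (∑-comm (λ i j → P (g i) (cycle g m j)))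
      (sum-const {m} (λ j → degree (toℕ j mod k)))

adj-sym : ∀ H i j → adj H i j ≡ adj H j i
adj-sym H i j = cong or (map-cong (λ { (u , v) → swap (suc (toℕ i)) (suc (toℕ j)) u v }) (edges H))
  where
  swap : ∀ x y u v → ((x ≡ᵇ u) ∧ (y ≡ᵇ v)) ∨ ((x ≡ᵇ v) ∧ (y ≡ᵇ u))
                   ≡ ((y ≡ᵇ u) ∧ (x ≡ᵇ v)) ∨ ((y ≡ᵇ v) ∧ (x ≡ᵇ u))
  swap x y u v = trans (∨-comm ((x ≡ᵇ u) ∧ (y ≡ᵇ v)) ((x ≡ᵇ v) ∧ (y ≡ᵇ u)))
                       (cong₂ _∨_ (∧-comm (x ≡ᵇ v) (y ≡ᵇ u)) (∧-comm (x ≡ᵇ u) (y ≡ᵇ v)))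

⌊≟⌋-sym : ∀ {n} (u v : Fin n) → ⌊ u ≟ v ⌋ ≡ ⌊ v ≟ u ⌋
⌊≟⌋-sym u v with u ≟ v | v ≟ u
... | yes _   | yes _   = refl
... | no  _   | no  _   = refl
... | yes u≡v | no  v≢u = contradiction (sym u≡v) v≢u
... | no  u≢v | yes v≡u = contradiction (sym v≡u) u≢v

^⟨⟩-sym : ∀ H a → Symmetric (H ^⟨ a ⟩)
^⟨⟩-sym H a u v =
  cong₂ (λ x y → if x then a ∸ 1 else (if y then suc a else a)) (⌊≟⌋-sym u v) (adj-sym H u v)

^⟨1⟩-diagonal : ∀ H u → (H ^⟨ 1 ⟩) u u ≡ 0
^⟨1⟩-diagonal H u with u ≟ u
... | yes _   = refl
... | no  u≢u = contradiction refl u≢u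

^⟨suc⟩≡+^⟨1⟩ : ∀ H b u v → (H ^⟨ suc b ⟩) u v ≡ b + (H ^⟨ 1 ⟩) u v
^⟨suc⟩≡+^⟨1⟩ H b u v with ⌊ u ≟ v ⌋ | adj H u v
... | true  | _     = sym (+-identityʳ b)
... | false | true  = +-comm 2 b
... | false | false = +-comm 1 b

IsΣ-cong : ∀ {n} {P Q : Pattern n} {s m} → (∀ u v → P u v ≡ Q u v) → IsΣ P s m → IsΣ Q s m
IsΣ-cong {P = P} {Q} P≗Q ((f , attained) , bounded) =
  (f , trans (sym (edgeCount-cong (λ i j → P≗Q (f i) (f j)))) attained) ,
  λ g → ≤-trans (≤-reflexive (edgeCount-cong (λ i j → sym (P≗Q (g i) (g j))))) (bounded g)

IsΣ-+ : ∀ {n} {P : Pattern n} {s m} b → IsΣ P s m → IsΣ (λ u v → b + P u v) s (b * (s C 2) + m)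
IsΣ-+ {P = P} b ((f , attained) , bounded) =
  (f , trans (edgeCount-+ b (blowUp P f)) (cong (b * _ +_) attained)) ,
  λ g → ≤-trans (≤-reflexive (edgeCount-+ b (blowUp P g))) (+-monoʳ-≤ _ (bounded g))

-- The bound ⌊3s²/5⌋

2*sC2+s≡s*s : ∀ s → 2 * (s C 2) + s ≡ s * s
2*sC2+s≡s*s zero    = refl
2*sC2+s≡s*s (suc s) = begin
  2 * (suc s C 2) + suc s          ≡⟨ cong (λ c → 2 * c + suc s) (suc[s]C2≡s+sC2 s) ⟩
  2 * (s + s C 2) + suc s          ≡⟨ step s (s C 2) ⟩
  (2 * (s C 2) + s) + (2 * s + 1)  ≡⟨ cong (_+ (2 * s + 1)) (2*sC2+s≡s*s s) ⟩
  s * s + (2 * s + 1)              ≡⟨ square s ⟩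
  suc s * suc s                    ∎
  where
  open ≡-Reasoning
  step : ∀ s c → 2 * (s + c) + suc s ≡ (2 * c + s) + (2 * s + 1)
  step = solve-∀
  square : ∀ s → s * s + (2 * s + 1) ≡ suc s * suc s
  square = solve-∀

-- C(s,2) + ⌊(s² + 5s)/10⌋ = ⌊(10 C(s,2) + s² + 5s)/10⌋ = ⌊6s²/10⌋.
target-suc : ∀ b s → target (suc b) s ≡ b * (s C 2) + 3 * (s * s) / 5
target-suc b s = begin
  suc b * c + (s * s + 5 * s) / 10
    ≡⟨ regroup b c ((s * s + 5 * s) / 10) ⟩
  b * c + (c + (s * s + 5 * s) / 10)
    ≡⟨ cong (λ x → b * c + (x + (s * s + 5 * s) / 10)) (m*n/n≡m c 10) ⟨
  b * c + (c * 10 / 10 + (s * s + 5 * s) / 10)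
    ≡⟨ cong (b * c +_) (+-distrib-/-∣ˡ (s * s + 5 * s) (divides-refl c)) ⟨
  b * c + (c * 10 + (s * s + 5 * s)) / 10
    ≡⟨ cong (λ x → b * c + x / 10) (six-squares c s (2*sC2+s≡s*s s)) ⟩
  b * c + 2 * (3 * (s * s)) / (2 * 5)
    ≡⟨ cong (b * c +_) (m*n/m*o≡n/o 2 (3 * (s * s)) 5) ⟩
  b * c + 3 * (s * s) / 5 ∎
  where
  open ≡-Reasoning
  c = s C 2
  regroup : ∀ b c d → suc b * c + d ≡ b * c + (c + d)
  regroup = solve-∀
  six-squares : ∀ c s → 2 * c + s ≡ s * s → c * 10 + (s * s + 5 * s) ≡ 2 * (3 * (s * s))
  six-squares c s eq = trans (expand c s) (trans (cong (λ x → 5 * x + s * s) eq) (collect (s * s)))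
    where
    expand : ∀ c s → c * 10 + (s * s + 5 * s) ≡ 5 * (2 * c + s) + s * s
    expand = solve-∀
    collect : ∀ x → 5 * x + x ≡ 2 * (3 * x)
    collect = solve-∀

3[5+m]²/5 : ∀ m → 3 * ((5 + m) * (5 + m)) / 5 ≡ 15 + m * 6 + 3 * (m * m) / 5
3[5+m]²/5 m = begin
  3 * ((5 + m) * (5 + m)) / 5             ≡⟨ cong (_/ 5) (expand m) ⟩
  (3 * (m * m) + (15 + m * 6) * 5) / 5    ≡⟨ +-distrib-/-∣ʳ (3 * (m * m)) (divides-refl (15 + m * 6)) ⟩
  3 * (m * m) / 5 + (15 + m * 6) * 5 / 5  ≡⟨ cong (3 * (m * m) / 5 +_) (m*n/n≡m (15 + m * 6) 5) ⟩
  3 * (m * m) / 5 + (15 + m * 6)          ≡⟨ +-comm (3 * (m * m) / 5) (15 + m * 6) ⟩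
  15 + m * 6 + 3 * (m * m) / 5            ∎
  where
  open ≡-Reasoning
  expand : ∀ m → 3 * ((5 + m) * (5 + m)) ≡ 3 * (m * m) + (15 + m * 6) * 5
  expand = solve-∀

m*n≤o⇒m≤o/n : ∀ {m o} n .{{_ : NonZero n}} → m * n ≤ o → m ≤ o / n
m*n≤o⇒m≤o/n {m} n m*n≤o = subst (_≤ _) (m*n/n≡m m n) (/-monoˡ-≤ n m*n≤o)

-- Certificates

pointwise : ∀ {n} (f g : Fin n → ℕ) → {True (all? λ i → f i ≟ℕ g i)} → ∀ i → f i ≡ g i
pointwise f g {equal} = toWitness equal

pointwise₂ : ∀ {n} (f g : Fin n → Fin n → ℕ) → {True (all? λ u → all? λ v → f u v ≟ℕ g u v)} →
  ∀ u v → f u v ≡ g u v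
pointwise₂ f g {equal} = toWitness equal

-- The data from which Σ_{H^(1)}(s) = ⌊3s²/5⌋ follows: the squares give 30 H^(1) ≤ 36 J as
-- quadratic forms, and the cyclic blow-ups of block attain the resulting bound.
record Σ-Certificate (H : Graph) : Set where
  field
    squares         : List (WeightedSquare (size H))
    squares-valid   : SumOfSquares (λ _ _ → 36) (λ u v → 30 * (H ^⟨ 1 ⟩) u v) squares
    block           : Fin 5 → Fin (size H)
    block-degree    : ∀ t → sum (λ i → (H ^⟨ 1 ⟩) (block i) (block t)) ≡ 6
    block-edgeCount : edgeCount (blowUp (H ^⟨ 1 ⟩) block) ≡ 15
    short-cycles    : ∀ (s : Fin 5) →
      edgeCount (blowUp (H ^⟨ 1 ⟩) (cycle block (toℕ s))) ≡ 3 * (toℕ s * toℕ s) / 5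

module _ {H : Graph} (certificate : Σ-Certificate H) where
  open Σ-Certificate certificate

  cycle-attains : ∀ s → edgeCount (blowUp (H ^⟨ 1 ⟩) (cycle block s)) ≡ 3 * (s * s) / 5
  cycle-attains 0 = short-cycles 0F
  cycle-attains 1 = short-cycles 1F
  cycle-attains 2 = short-cycles 2F
  cycle-attains 3 = short-cycles 3F
  cycle-attains 4 = short-cycles 4F
  cycle-attains (suc (suc (suc (suc (suc m))))) = begin
    edgeCount (blowUp (H ^⟨ 1 ⟩) (cycle block (5 + m)))
      ≡⟨ edgeCount-cycle block (H ^⟨ 1 ⟩) 6 block-degree m ⟩
    edgeCount (blowUp (H ^⟨ 1 ⟩) block) + m * 6 + edgeCount (blowUp (H ^⟨ 1 ⟩) (cycle block m))
      ≡⟨ cong₂ (λ x y → x + m * 6 + y) block-edgeCount (cycle-attains m) ⟩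
    15 + m * 6 + 3 * (m * m) / 5
      ≡⟨ 3[5+m]²/5 m ⟨
    3 * ((5 + m) * (5 + m)) / 5 ∎
    where open ≡-Reasoning

  edgeCount-bounded : ∀ {s} (f : Fin s → Fin (size H)) →
    edgeCount (blowUp (H ^⟨ 1 ⟩) f) ≤ 3 * (s * s) / 5
  edgeCount-bounded {s} f = m*n≤o⇒m≤o/n {o = 3 * (s * s)} 5 (*-cancelˡ-≤ 12 (begin
    12 * (e * 5)                          ≡⟨ scale e ⟩
    30 * (2 * e)                          ≡⟨ cong (30 *_) (2*edgeCount≡pairSum (blowUp P f) symmetric diagonal) ⟩
    30 * pairSum (blowUp P f)             ≡⟨ *-distribˡ-pairSum 30 (blowUp P f) ⟩
    pairSum (λ i j → 30 * P (f i) (f j))  ≤⟨ SumOfSquares⇒pairSum-≤ {ts = squares} squares-valid f ⟩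
    pairSum {s} (λ _ _ → 36)              ≡⟨ sum-const {s} (λ i → sum-const {s} (λ j → refl)) ⟩
    s * (s * 36)                          ≡⟨ square s ⟩
    12 * (3 * (s * s))                    ∎))
    where
    open ≤-Reasoning
    P = H ^⟨ 1 ⟩
    e = edgeCount (blowUp P f)
    symmetric : Symmetric (blowUp P f)
    symmetric i j = ^⟨⟩-sym H 1 (f i) (f j)
    diagonal : ∀ i → P (f i) (f i) ≡ 0
    diagonal i = ^⟨1⟩-diagonal H (f i)
    scale : ∀ e → 12 * (e * 5) ≡ 30 * (2 * e)
    scale = solve-∀
    square : ∀ s → s * (s * 36) ≡ 12 * (3 * (s * s))
    square = solve-∀

  Σ-certified : ∀ s → IsΣ (H ^⟨ 1 ⟩) s (3 * (s * s) / 5)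
  Σ-certified s = (cycle block s , cycle-attains s) , edgeCount-bounded

certificate : ∀ G → Σ-Certificate (graphOf G)
certificate K13 = record
  { squares =
      1  *⟨ lookup (6 ∷ 0 ∷ 0 ∷ 0 ∷ []) - lookup (0 ∷ 4 ∷ 4 ∷ 4 ∷ []) ⟩² ∷
      5  *⟨ lookup (0 ∷ 2 ∷ 0 ∷ 0 ∷ []) - lookup (0 ∷ 0 ∷ 1 ∷ 1 ∷ []) ⟩² ∷
      15 *⟨ lookup (0 ∷ 0 ∷ 1 ∷ 0 ∷ []) - lookup (0 ∷ 0 ∷ 0 ∷ 1 ∷ []) ⟩² ∷ []
  ; squares-valid = pointwise₂ _ _
  ; block = lookup (0F ∷ 1F ∷ 2F ∷ 0F ∷ 3F ∷ [])
  ; block-degree = pointwise _ _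
  ; block-edgeCount = refl
  ; short-cycles = pointwise _ _
  }
certificate C5cycle = record
  { squares =
      1  *⟨ lookup (6 ∷ 0 ∷ 1 ∷ 1 ∷ 0 ∷ []) - lookup (0 ∷ 4 ∷ 0 ∷ 0 ∷ 4 ∷ []) ⟩² ∷
      5  *⟨ lookup (0 ∷ 2 ∷ 0 ∷ 1 ∷ 0 ∷ []) - lookup (0 ∷ 0 ∷ 2 ∷ 0 ∷ 1 ∷ []) ⟩² ∷
      15 *⟨ lookup (0 ∷ 0 ∷ 1 ∷ 0 ∷ 0 ∷ []) - lookup (0 ∷ 0 ∷ 0 ∷ 1 ∷ 0 ∷ []) ⟩² ∷
      15 *⟨ lookup (0 ∷ 0 ∷ 0 ∷ 1 ∷ 0 ∷ []) - lookup (0 ∷ 0 ∷ 0 ∷ 0 ∷ 1 ∷ []) ⟩² ∷ []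
  ; squares-valid = pointwise₂ _ _
  ; block = lookup (0F ∷ 1F ∷ 2F ∷ 3F ∷ 4F ∷ [])
  ; block-degree = pointwise _ _
  ; block-edgeCount = refl
  ; short-cycles = pointwise _ _
  }
certificate H6 = record
  { squares =
      1  *⟨ lookup (6 ∷ 0 ∷ 0 ∷ 0 ∷ 1 ∷ 1 ∷ []) - lookup (0 ∷ 4 ∷ 4 ∷ 4 ∷ 0 ∷ 0 ∷ []) ⟩² ∷
      5  *⟨ lookup (0 ∷ 2 ∷ 0 ∷ 0 ∷ 0 ∷ 0 ∷ []) - lookup (0 ∷ 0 ∷ 1 ∷ 1 ∷ 2 ∷ 2 ∷ []) ⟩² ∷
      15 *⟨ lookup (0 ∷ 0 ∷ 1 ∷ 0 ∷ 0 ∷ 0 ∷ []) - lookup (0 ∷ 0 ∷ 0 ∷ 1 ∷ 0 ∷ 0 ∷ []) ⟩² ∷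
      15 *⟨ lookup (0 ∷ 0 ∷ 0 ∷ 0 ∷ 1 ∷ 0 ∷ []) - lookup (0 ∷ 0 ∷ 0 ∷ 0 ∷ 0 ∷ 1 ∷ []) ⟩² ∷ []
  ; squares-valid = pointwise₂ _ _
  ; block = lookup (0F ∷ 1F ∷ 2F ∷ 0F ∷ 3F ∷ [])
  ; block-degree = pointwise _ _
  ; block-edgeCount = refl
  ; short-cycles = pointwise _ _
  }
certificate H7 = record
  { squares =
      1  *⟨ lookup (6 ∷ 0 ∷ 1 ∷ 1 ∷ 0 ∷ 0 ∷ 1 ∷ []) - lookup (0 ∷ 4 ∷ 0 ∷ 0 ∷ 4 ∷ 4 ∷ 0 ∷ []) ⟩² ∷
      5  *⟨ lookup (0 ∷ 2 ∷ 0 ∷ 1 ∷ 0 ∷ 0 ∷ 1 ∷ []) - lookup (0 ∷ 0 ∷ 2 ∷ 0 ∷ 1 ∷ 1 ∷ 0 ∷ []) ⟩² ∷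
      15 *⟨ lookup (0 ∷ 0 ∷ 1 ∷ 0 ∷ 0 ∷ 0 ∷ 1 ∷ []) - lookup (0 ∷ 0 ∷ 0 ∷ 1 ∷ 0 ∷ 0 ∷ 0 ∷ []) ⟩² ∷
      15 *⟨ lookup (0 ∷ 0 ∷ 0 ∷ 1 ∷ 0 ∷ 1 ∷ 0 ∷ []) - lookup (0 ∷ 0 ∷ 0 ∷ 0 ∷ 1 ∷ 0 ∷ 1 ∷ []) ⟩² ∷ []
  ; squares-valid = pointwise₂ _ _
  ; block = lookup (0F ∷ 1F ∷ 2F ∷ 3F ∷ 4F ∷ [])
  ; block-degree = pointwise _ _
  ; block-edgeCount = refl
  ; short-cycles = pointwise _ _
  }
certificate H9 = record
  { squares =
      1  *⟨ lookup (6 ∷ 0 ∷ 1 ∷ 1 ∷ 1 ∷ 0 ∷ 0 ∷ 1 ∷ 1 ∷ []) - lookup (0 ∷ 4 ∷ 0 ∷ 0 ∷ 0 ∷ 4 ∷ 4 ∷ 0 ∷ 0 ∷ []) ⟩² ∷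
      5  *⟨ lookup (0 ∷ 2 ∷ 0 ∷ 1 ∷ 1 ∷ 0 ∷ 0 ∷ 0 ∷ 1 ∷ []) - lookup (0 ∷ 0 ∷ 2 ∷ 0 ∷ 0 ∷ 1 ∷ 1 ∷ 2 ∷ 0 ∷ []) ⟩² ∷
      15 *⟨ lookup (0 ∷ 0 ∷ 1 ∷ 0 ∷ 1 ∷ 0 ∷ 0 ∷ 0 ∷ 0 ∷ []) - lookup (0 ∷ 0 ∷ 0 ∷ 1 ∷ 0 ∷ 0 ∷ 0 ∷ 1 ∷ 1 ∷ []) ⟩² ∷
      15 *⟨ lookup (0 ∷ 0 ∷ 0 ∷ 1 ∷ 0 ∷ 1 ∷ 0 ∷ 0 ∷ 0 ∷ []) - lookup (0 ∷ 0 ∷ 0 ∷ 0 ∷ 1 ∷ 0 ∷ 1 ∷ 0 ∷ 1 ∷ []) ⟩² ∷ []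
  ; squares-valid = pointwise₂ _ _
  ; block = lookup (0F ∷ 1F ∷ 2F ∷ 3F ∷ 6F ∷ [])
  ; block-degree = pointwise _ _
  ; block-edgeCount = refl
  ; short-cycles = pointwise _ _
  }
certificate Petersen = record
  { squares =
      1  *⟨ lookup (6 ∷ 0 ∷ 1 ∷ 1 ∷ 0 ∷ 0 ∷ 1 ∷ 1 ∷ 1 ∷ 1 ∷ []) - lookup (0 ∷ 4 ∷ 0 ∷ 0 ∷ 4 ∷ 4 ∷ 0 ∷ 0 ∷ 0 ∷ 0 ∷ []) ⟩² ∷
      5  *⟨ lookup (0 ∷ 2 ∷ 0 ∷ 1 ∷ 0 ∷ 0 ∷ 0 ∷ 1 ∷ 1 ∷ 1 ∷ []) - lookup (0 ∷ 0 ∷ 2 ∷ 0 ∷ 1 ∷ 1 ∷ 2 ∷ 0 ∷ 0 ∷ 0 ∷ []) ⟩² ∷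
      15 *⟨ lookup (0 ∷ 0 ∷ 1 ∷ 0 ∷ 0 ∷ 0 ∷ 0 ∷ 0 ∷ 1 ∷ 1 ∷ []) - lookup (0 ∷ 0 ∷ 0 ∷ 1 ∷ 0 ∷ 0 ∷ 1 ∷ 1 ∷ 0 ∷ 0 ∷ []) ⟩² ∷
      15 *⟨ lookup (0 ∷ 0 ∷ 0 ∷ 1 ∷ 0 ∷ 1 ∷ 0 ∷ 0 ∷ 0 ∷ 1 ∷ []) - lookup (0 ∷ 0 ∷ 0 ∷ 0 ∷ 1 ∷ 0 ∷ 0 ∷ 1 ∷ 1 ∷ 0 ∷ []) ⟩² ∷ []
  ; squares-valid = pointwise₂ _ _
  ; block = lookup (0F ∷ 1F ∷ 2F ∷ 3F ∷ 4F ∷ [])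
  ; block-degree = pointwise _ _
  ; block-edgeCount = refl
  ; short-cycles = pointwise _ _
  }

proposition1p20 : (a s : ℕ) → 1 ≤ a → 1 ≤ s → (G : C5) →
    IsΣ (graphOf G ^⟨ a ⟩) s (target a s)
proposition1p20 (suc b) s _ _ G =
  IsΣ-cong (λ u v → sym (^⟨suc⟩≡+^⟨1⟩ H b u v))
    (subst (IsΣ (λ u v → b + (H ^⟨ 1 ⟩) u v) s) (sym (target-suc b s))
      (IsΣ-+ {P = H ^⟨ 1 ⟩} b (Σ-certified (certificate G) s)))
  where H = graphOf G
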